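{- Let $R$ be the ring of all $3\times 3$ matrices over $GF(2)$ of the form $$M(a,b,c,d)=\begin{pmatrix} a & c & d\\ 0 & b & 0\\ 0 & 0 & b\end{pmatrix},\qquad a,b,c,d\in GF(2),$$ and write $0=M(0,0,0,0)$, $3=M(0,0,1,0)$, $5=M(0,0,1,1)$, $6=M(0,0,0,1)$, $8=M(0,1,0,0)$, $11=M(0,1,1,0)$, $13=M(0,1,1,1)$, $14=M(0,1,0,1)$. Let $J=\{0,3,5,6\}$ (the Jacobson radical of $R$), and let $\mathcal{D}$ be the point-line incidence structure (the doily) whose points are the $15$ vectors of $J^2\setminus\{(0,0)\}$ and whose lines are defined in the context below. Then for each of the nine submodules $$R(3,8),\ R(5,8),\ R(6,8),\ R(8,11),\ R(8,13),\ R(8,14),\ R(8,6),\ R(8,5),\ R(8,3)$$ of the free left module $R^2$, the set $R(x,y)\cap\big(J^2\setminus\{(0,0)\}\big)$ consists of exactly seven points of $\mathcal{D}$, and these seven points form the union of three lines of $\mathcal{D}$ passing through a common point.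
   Context: For $(x,y)\in R^2$, $R(x,y)=\{(\alpha x,\alpha y):\alpha\in R\}$. The doily $\mathcal{D}$ (generalized quadrangle of order two) is defined via the duad–syntheme model: for $S=\{1,\dots,6\}$, a duad is a $2$-element subset of $S$ and a syntheme is a set of three pairwise disjoint duads (a partition of $S$). Identify duads with points of $J^2\setminus\{(0,0)\}$ via the bijection $\{1,2\}\leftrightarrow(3,3)$, $\{1,3\}\leftrightarrow(5,3)$, $\{1,4\}\leftrightarrow(0,6)$, $\{1,5\}\leftrightarrow(3,6)$, $\{1,6\}\leftrightarrow(5,0)$, $\{2,3\}\leftrightarrow(6,0)$, $\{2,4\}\leftrightarrow(3,5)$, $\{2,5\}\leftrightarrow(0,5)$, $\{2,6\}\leftrightarrow(6,3)$, $\{3,4\}\leftrightarrow(5,5)$, $\{3,5\}\leftrightarrow(6,5)$, $\{3,6\}\leftrightarrow(0,3)$, $\{4,5\}\leftrightarrow(3,0)$, $\{4,6\}\leftrightarrow(5,6)$, $\{5,6\}\leftrightarrow(6,6)$. The lines of $\mathcal{D}$ are the $15$ synthemes, i.e. a line is the set of three points corresponding to the three duads of a syntheme; incidence is containment. -}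

module Defs where

open import Data.Bool using (Bool; true; false; _∧_; _xor_)
open import Data.Fin using (Fin; zero; suc; _<_)
open import Data.Vec using (Vec; []; _∷_; lookup; tabulate)
open import Data.Product using (Σ; _×_; _,_; proj₁; proj₂; ∃-syntax)
open import Data.Sum using (_⊎_)
open import Data.List using (List; []; _∷_; length)
open import Relation.Binary.PropositionalEquality using (_≡_)
open import Relation.Nullary using (¬_)

-- GF(2) is modelled by Bool: addition = xor, multiplication = ∧.

Mat : Set
Mat = Vec (Vec Bool 3) 3

Σ3 : (Fin 3 → Bool) → Bool
Σ3 f = f zero xor (f (suc zero) xor f (suc (suc zero)))

_·_ : Mat → Mat → Mat
A · B = tabulate λ i → tabulate λ j →
          Σ3 (λ k → lookup (lookup A i) k ∧ lookup (lookup B k) j)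

M : Bool → Bool → Bool → Bool → Mat
M a b c d = (a ∷ c ∷ d ∷ []) ∷ (false ∷ b ∷ false ∷ []) ∷ (false ∷ false ∷ b ∷ []) ∷ []

InR : Mat → Set
InR m = ∃[ a ] ∃[ b ] ∃[ c ] ∃[ d ] (m ≡ M a b c d)

e0 e3 e5 e6 e8 e11 e13 e14 : Mat
e0  = M false false false false
e3  = M false false true  false
e5  = M false false true  true
e6  = M false false false true
e8  = M false true  false false
e11 = M false true  true  false
e13 = M false true  true  true
e14 = M false true  false true

InJ : Mat → Set
InJ m = m ≡ e0 ⊎ m ≡ e3 ⊎ m ≡ e5 ⊎ m ≡ e6

Pt : Set
Pt = Mat × Mat

InJ2* : Pt → Set
InJ2* q = InJ (proj₁ q) × InJ (proj₂ q) × ¬ (q ≡ (e0 , e0))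

InSpan : Pt → Pt → Set
InSpan (x , y) q = ∃[ α ] (InR α × q ≡ (α · x , α · y))

-- The doily: duad–syntheme model on S = {1,…,6} (Fin 6, 0-based).

Duad : Set
Duad = Σ (Fin 6 × Fin 6) (λ ij → proj₁ ij < proj₂ ij)

Disjoint : Duad → Duad → Set
Disjoint ((i , j) , _) ((k , l) , _) =
  ¬ (i ≡ k) × ¬ (i ≡ l) × ¬ (j ≡ k) × ¬ (j ≡ l)

record Syntheme : Set where
  field
    d₁ d₂ d₃ : Duad
    dis₁₂ : Disjoint d₁ d₂
    dis₁₃ : Disjoint d₁ d₃
    dis₂₃ : Disjoint d₂ d₃

-- the bijection duads ↔ points of J² ∖ {(0,0)} given in the paper
pt′ : Fin 6 → Fin 6 → Pt
pt′ zero (suc zero) = (e3 , e3)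
pt′ zero (suc (suc zero)) = (e5 , e3)
pt′ zero (suc (suc (suc zero))) = (e0 , e6)
pt′ zero (suc (suc (suc (suc zero)))) = (e3 , e6)
pt′ zero (suc (suc (suc (suc (suc zero))))) = (e5 , e0)
pt′ (suc zero) (suc (suc zero)) = (e6 , e0)
pt′ (suc zero) (suc (suc (suc zero))) = (e3 , e5)
pt′ (suc zero) (suc (suc (suc (suc zero)))) = (e0 , e5)
pt′ (suc zero) (suc (suc (suc (suc (suc zero))))) = (e6 , e3)
pt′ (suc (suc zero)) (suc (suc (suc zero))) = (e5 , e5)
pt′ (suc (suc zero)) (suc (suc (suc (suc zero)))) = (e6 , e5)
pt′ (suc (suc zero)) (suc (suc (suc (suc (suc zero))))) = (e0 , e3)
pt′ (suc (suc (suc zero))) (suc (suc (suc (suc zero)))) = (e3 , e0)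
pt′ (suc (suc (suc zero))) (suc (suc (suc (suc (suc zero))))) = (e5 , e6)
pt′ (suc (suc (suc (suc zero)))) (suc (suc (suc (suc (suc zero))))) = (e6 , e6)
pt′ _ _ = (e0 , e0)   -- never used: only i < j is ever passed

pt : Duad → Pt
pt ((i , j) , _) = pt′ i j

OnLine : Pt → Syntheme → Set
OnLine q L = q ≡ pt (Syntheme.d₁ L) ⊎ q ≡ pt (Syntheme.d₂ L) ⊎ q ≡ pt (Syntheme.d₃ L)

DistinctLines : Syntheme → Syntheme → Set
DistinctLines L L′ = ¬ (∀ q → (OnLine q L → OnLine q L′) × (OnLine q L′ → OnLine q L))

nine : List Pt
nine = (e3 , e8) ∷ (e5 , e8) ∷ (e6 , e8) ∷ (e8 , e11) ∷ (e8 , e13)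
     ∷ (e8 , e14) ∷ (e8 , e6) ∷ (e8 , e5) ∷ (e8 , e3) ∷ []

-- Since R has only sixteen elements, R(x,y) is the image of a finite list and its points in
-- J² ∖ {(0,0)} can be computed. In each of the nine cases they form the perp of one point p of
-- the doily: p together with all points collinear with it, i.e. the union of the three lines
-- through p. If p is the duad {i,j}, these are the three synthemes containing {i,j}, one for
-- each way of splitting the remaining four labels into two duads. Incidence, distinctness of
-- lines and equality of finite point sets are decidable, so every case is checked by evaluation.
module Submission where

open import Defs
open import Data.Nat using (ℕ)
open import Data.Bool using (Bool; true; false)
import Data.Bool as Bool
open import Data.Fin using (Fin; _<?_; #_)
import Data.Fin.Properties as Fin
open import Data.List using (List; []; _∷_; length; map; filter; deduplicate; _++_; cartesianProduct)
open import Data.List.Membership.Propositional using (_∈_)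
open import Data.List.Membership.Propositional.Properties
  using (∈-map⁺; ∈-map⁻; ∈-filter⁺; ∈-filter⁻; ∈-deduplicate⁺; ∈-deduplicate⁻; ∈-cartesianProduct⁺; ∈-++⁺ˡ; ∈-++⁺ʳ; ∈-++⁻)
open import Data.List.Relation.Binary.Subset.Propositional using (_⊆_)
open import Data.List.Relation.Unary.All as All using (All; []; _∷_)
open import Data.List.Relation.Unary.Any using (here; there)
open import Data.List.Relation.Unary.Unique.Propositional using (Unique)
open import Data.List.Relation.Unary.Unique.DecPropositional.Properties using (deduplicate-!)
open import Data.Product using (_×_; _,_; proj₁; proj₂; ∃-syntax)
import Data.Product.Properties as Product
open import Data.Sum using (_⊎_; inj₁; inj₂)
import Data.Vec.Properties as Vec
open import Relation.Binary.Definitions using (DecidableEquality)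
open import Relation.Binary.PropositionalEquality using (_≡_; refl)
open import Relation.Nullary using (¬_; Dec; ¬?; _×-dec_; _⊎-dec_)
open import Relation.Nullary.Decidable using (True; toWitness)

_≟ᴹ_ : DecidableEquality Mat
_≟ᴹ_ = Vec.≡-dec (Vec.≡-dec Bool._≟_)

_≟ᴾ_ : DecidableEquality Pt
_≟ᴾ_ = Product.≡-dec _≟ᴹ_ _≟ᴹ_

open import Data.List.Membership.DecPropositional _≟ᴾ_ using (_∈?_)
open import Data.List.Relation.Binary.Subset.DecPropositional _≟ᴾ_ using (_⊆?_)

bools : List Bool
bools = false ∷ true ∷ []

∈-bools : ∀ b → b ∈ bools
∈-bools false = here refl
∈-bools true = there (here refl)

Coords : Set
Coords = Bool × Bool × Bool × Bool

allCoords : List Coords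
allCoords = cartesianProduct bools (cartesianProduct bools (cartesianProduct bools bools))

Mᶜ : Coords → Mat
Mᶜ (a , b , c , d) = M a b c d

elementsR : List Mat
elementsR = map Mᶜ allCoords

InR⇒∈elementsR : ∀ {α} → InR α → α ∈ elementsR
InR⇒∈elementsR (a , b , c , d , refl) =
  ∈-map⁺ Mᶜ (∈-cartesianProduct⁺ (∈-bools a)
           (∈-cartesianProduct⁺ (∈-bools b) (∈-cartesianProduct⁺ (∈-bools c) (∈-bools d))))

∈elementsR⇒InR : ∀ {α} → α ∈ elementsR → InR α
∈elementsR⇒InR α∈ with (a , b , c , d) , _ , α≡ ← ∈-map⁻ Mᶜ α∈ = a , b , c , d , α≡

_·ᴾ_ : Mat → Pt → Pt
α ·ᴾ (x , y) = α · x , α · y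

spanList : Pt → List Pt
spanList xy = map (_·ᴾ xy) elementsR

InSpan⇒∈spanList : ∀ xy {q} → InSpan xy q → q ∈ spanList xy
InSpan⇒∈spanList xy (α , α∈R , refl) = ∈-map⁺ (_·ᴾ xy) (InR⇒∈elementsR α∈R)

∈spanList⇒InSpan : ∀ xy {q} → q ∈ spanList xy → InSpan xy q
∈spanList⇒InSpan (x , y) q∈ with α , α∈ , q≡ ← ∈-map⁻ (_·ᴾ (x , y)) q∈ = α , ∈elementsR⇒InR α∈ , q≡

InJ? : ∀ m → Dec (InJ m)
InJ? m = m ≟ᴹ e0 ⊎-dec m ≟ᴹ e3 ⊎-dec m ≟ᴹ e5 ⊎-dec m ≟ᴹ e6

InJ2*? : ∀ q → Dec (InJ2* q)
InJ2*? q = InJ? (proj₁ q) ×-dec InJ? (proj₂ q) ×-dec ¬? (q ≟ᴾ (e0 , e0))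

SpanPoint : Pt → Pt → Set
SpanPoint xy q = InSpan xy q × InJ2* q

spanPoints : Pt → List Pt
spanPoints xy = deduplicate _≟ᴾ_ (filter InJ2*? (spanList xy))

SpanPoint⇒∈spanPoints : ∀ xy {q} → SpanPoint xy q → q ∈ spanPoints xy
SpanPoint⇒∈spanPoints xy (q∈span , q∈J2*) =
  ∈-deduplicate⁺ _≟ᴾ_ (∈-filter⁺ InJ2*? (InSpan⇒∈spanList xy q∈span) q∈J2*)

∈spanPoints⇒SpanPoint : ∀ xy {q} → q ∈ spanPoints xy → SpanPoint xy q
∈spanPoints⇒SpanPoint xy q∈ with q∈span , q∈J2* ← ∈-filter⁻ InJ2*? (∈-deduplicate⁻ _≟ᴾ_ _ q∈) =
  ∈spanList⇒InSpan xy q∈span , q∈J2*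

-- Labels are 0-based as in Defs: duad (# 2) (# 5) is the paper's {3,6}.
duad : (i j : Fin 6) → {True (i <? j)} → Duad
duad i j {i<j} = (i , j) , toWitness i<j

disjoint? : ∀ d d′ → Dec (Disjoint d d′)
disjoint? ((i , j) , _) ((k , l) , _) =
  ¬? (i Fin.≟ k) ×-dec ¬? (i Fin.≟ l) ×-dec ¬? (j Fin.≟ k) ×-dec ¬? (j Fin.≟ l)

syntheme : (d₁ d₂ d₃ : Duad) →
  {True (disjoint? d₁ d₂)} → {True (disjoint? d₁ d₃)} → {True (disjoint? d₂ d₃)} → Syntheme
syntheme d₁ d₂ d₃ {d₁#d₂} {d₁#d₃} {d₂#d₃} = record
  { d₁ = d₁ ; d₂ = d₂ ; d₃ = d₃
  ; dis₁₂ = toWitness d₁#d₂ ; dis₁₃ = toWitness d₁#d₃ ; dis₂₃ = toWitness d₂#d₃ }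

pointsOn : Syntheme → List Pt
pointsOn L = pt (Syntheme.d₁ L) ∷ pt (Syntheme.d₂ L) ∷ pt (Syntheme.d₃ L) ∷ []

OnLine⇒∈pointsOn : ∀ {q} L → OnLine q L → q ∈ pointsOn L
OnLine⇒∈pointsOn L (inj₁ q≡) = here q≡
OnLine⇒∈pointsOn L (inj₂ (inj₁ q≡)) = there (here q≡)
OnLine⇒∈pointsOn L (inj₂ (inj₂ q≡)) = there (there (here q≡))

∈pointsOn⇒OnLine : ∀ {q} L → q ∈ pointsOn L → OnLine q L
∈pointsOn⇒OnLine L (here q≡) = inj₁ q≡
∈pointsOn⇒OnLine L (there (here q≡)) = inj₂ (inj₁ q≡)
∈pointsOn⇒OnLine L (there (there (here q≡))) = inj₂ (inj₂ q≡)

⊈⇒DistinctLines : ∀ L L′ → ¬ pointsOn L ⊆ pointsOn L′ → DistinctLines L L′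
⊈⇒DistinctLines L L′ L⊈L′ same = L⊈L′ λ q∈L →
  OnLine⇒∈pointsOn L′ (proj₁ (same _) (∈pointsOn⇒OnLine L q∈L))

OnSomeLine : Pt → Syntheme → Syntheme → Syntheme → Set
OnSomeLine q L₁ L₂ L₃ = OnLine q L₁ ⊎ OnLine q L₂ ⊎ OnLine q L₃

pointsOn₃ : Syntheme → Syntheme → Syntheme → List Pt
pointsOn₃ L₁ L₂ L₃ = pointsOn L₁ ++ pointsOn L₂ ++ pointsOn L₃

OnSomeLine⇒∈pointsOn₃ : ∀ {q} L₁ L₂ L₃ → OnSomeLine q L₁ L₂ L₃ → q ∈ pointsOn₃ L₁ L₂ L₃
OnSomeLine⇒∈pointsOn₃ L₁ L₂ L₃ (inj₁ q∈L₁) = ∈-++⁺ˡ (OnLine⇒∈pointsOn L₁ q∈L₁)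
OnSomeLine⇒∈pointsOn₃ L₁ L₂ L₃ (inj₂ (inj₁ q∈L₂)) =
  ∈-++⁺ʳ (pointsOn L₁) (∈-++⁺ˡ (OnLine⇒∈pointsOn L₂ q∈L₂))
OnSomeLine⇒∈pointsOn₃ L₁ L₂ L₃ (inj₂ (inj₂ q∈L₃)) =
  ∈-++⁺ʳ (pointsOn L₁) (∈-++⁺ʳ (pointsOn L₂) (OnLine⇒∈pointsOn L₃ q∈L₃))

∈pointsOn₃⇒OnSomeLine : ∀ {q} L₁ L₂ L₃ → q ∈ pointsOn₃ L₁ L₂ L₃ → OnSomeLine q L₁ L₂ L₃
∈pointsOn₃⇒OnSomeLine L₁ L₂ L₃ q∈ with ∈-++⁻ (pointsOn L₁) q∈
... | inj₁ q∈L₁ = inj₁ (∈pointsOn⇒OnLine L₁ q∈L₁)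
... | inj₂ q∈L₂₃ with ∈-++⁻ (pointsOn L₂) q∈L₂₃
...   | inj₁ q∈L₂ = inj₂ (inj₁ (∈pointsOn⇒OnLine L₂ q∈L₂))
...   | inj₂ q∈L₃ = inj₂ (inj₂ (∈pointsOn⇒OnLine L₃ q∈L₃))

ThreeLinesThrough : Pt → Syntheme → Syntheme → Syntheme → Set
ThreeLinesThrough p L₁ L₂ L₃ =
  p ∈ pointsOn L₁ × p ∈ pointsOn L₂ × p ∈ pointsOn L₃
  × ¬ pointsOn L₁ ⊆ pointsOn L₂ × ¬ pointsOn L₁ ⊆ pointsOn L₃ × ¬ pointsOn L₂ ⊆ pointsOn L₃

threeLinesThrough? : ∀ p L₁ L₂ L₃ → Dec (ThreeLinesThrough p L₁ L₂ L₃)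
threeLinesThrough? p L₁ L₂ L₃ =
  (p ∈? pointsOn L₁) ×-dec (p ∈? pointsOn L₂) ×-dec (p ∈? pointsOn L₃)
  ×-dec ¬? (pointsOn L₁ ⊆? pointsOn L₂) ×-dec ¬? (pointsOn L₁ ⊆? pointsOn L₃)
  ×-dec ¬? (pointsOn L₂ ⊆? pointsOn L₃)

SpanIsUnionOf : Pt → Syntheme → Syntheme → Syntheme → Set
SpanIsUnionOf xy L₁ L₂ L₃ = spanPoints xy ⊆ pointsOn₃ L₁ L₂ L₃ × pointsOn₃ L₁ L₂ L₃ ⊆ spanPoints xy

spanIsUnionOf? : ∀ xy L₁ L₂ L₃ → Dec (SpanIsUnionOf xy L₁ L₂ L₃)
spanIsUnionOf? xy L₁ L₂ L₃ = (spanPoints xy ⊆? pointsOn₃ L₁ L₂ L₃) ×-dec (pointsOn₃ L₁ L₂ L₃ ⊆? spanPoints xy)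

ListedExactlyBy : (Pt → Set) → ℕ → Set
ListedExactlyBy P n = ∃[ ps ] (length ps ≡ n × Unique ps × (∀ q → (P q → q ∈ ps) × (q ∈ ps → P q)))

UnionOfConcurrentLines : (Pt → Set) → Set
UnionOfConcurrentLines P = ∃[ p ] ∃[ L₁ ] ∃[ L₂ ] ∃[ L₃ ]
  (OnLine p L₁ × OnLine p L₂ × OnLine p L₃
  × DistinctLines L₁ L₂ × DistinctLines L₁ L₃ × DistinctLines L₂ L₃
  × (∀ q → (P q → OnSomeLine q L₁ L₂ L₃) × (OnSomeLine q L₁ L₂ L₃ → P q)))

spanPoints-listing : ∀ xy {n} → length (spanPoints xy) ≡ n → ListedExactlyBy (SpanPoint xy) n
spanPoints-listing xy length≡n =
  spanPoints xy , length≡n , deduplicate-! _≟ᴾ_ _ ,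
  λ q → SpanPoint⇒∈spanPoints xy , ∈spanPoints⇒SpanPoint xy

union-of-lines-through : ∀ xy p L₁ L₂ L₃ →
  {True (threeLinesThrough? p L₁ L₂ L₃)} → {True (spanIsUnionOf? xy L₁ L₂ L₃)} →
  UnionOfConcurrentLines (SpanPoint xy)
union-of-lines-through xy p L₁ L₂ L₃ {through} {union}
  with p∈L₁ , p∈L₂ , p∈L₃ , L₁⊈L₂ , L₁⊈L₃ , L₂⊈L₃ ← toWitness through
     | span⊆lines , lines⊆span ← toWitness union =
  p , L₁ , L₂ , L₃ ,
  ∈pointsOn⇒OnLine L₁ p∈L₁ , ∈pointsOn⇒OnLine L₂ p∈L₂ , ∈pointsOn⇒OnLine L₃ p∈L₃ ,
  ⊈⇒DistinctLines L₁ L₂ L₁⊈L₂ , ⊈⇒DistinctLines L₁ L₃ L₁⊈L₃ , ⊈⇒DistinctLines L₂ L₃ L₂⊈L₃ ,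
  λ q → (λ q∈span → ∈pointsOn₃⇒OnSomeLine L₁ L₂ L₃ (span⊆lines (SpanPoint⇒∈spanPoints xy q∈span)))
      , (λ q∈lines → ∈spanPoints⇒SpanPoint xy (lines⊆span (OnSomeLine⇒∈pointsOn₃ L₁ L₂ L₃ q∈lines)))

spans-have-seven-points : All (λ xy → length (spanPoints xy) ≡ 7) nine
spans-have-seven-points = refl ∷ refl ∷ refl ∷ refl ∷ refl ∷ refl ∷ refl ∷ refl ∷ refl ∷ []

span-is-pencil : ∀ {xy} → xy ∈ nine → UnionOfConcurrentLines (SpanPoint xy)
span-is-pencil (here refl) = union-of-lines-through (e3 , e8) (pt c)
  (syntheme c (duad (# 0) (# 1)) (duad (# 3) (# 4)))
  (syntheme c (duad (# 0) (# 3)) (duad (# 1) (# 4)))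
  (syntheme c (duad (# 0) (# 4)) (duad (# 1) (# 3)))
  where c = duad (# 2) (# 5)
span-is-pencil (there (here refl)) = union-of-lines-through (e5 , e8) (pt c)
  (syntheme c (duad (# 0) (# 2)) (duad (# 3) (# 5)))
  (syntheme c (duad (# 0) (# 3)) (duad (# 2) (# 5)))
  (syntheme c (duad (# 0) (# 5)) (duad (# 2) (# 3)))
  where c = duad (# 1) (# 4)
span-is-pencil (there (there (here refl))) = union-of-lines-through (e6 , e8) (pt c)
  (syntheme c (duad (# 1) (# 2)) (duad (# 4) (# 5)))
  (syntheme c (duad (# 1) (# 4)) (duad (# 2) (# 5)))
  (syntheme c (duad (# 1) (# 5)) (duad (# 2) (# 4)))
  where c = duad (# 0) (# 3)
span-is-pencil (there (there (there (here refl)))) = union-of-lines-through (e8 , e11) (pt c)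
  (syntheme c (duad (# 2) (# 3)) (duad (# 4) (# 5)))
  (syntheme c (duad (# 2) (# 4)) (duad (# 3) (# 5)))
  (syntheme c (duad (# 2) (# 5)) (duad (# 3) (# 4)))
  where c = duad (# 0) (# 1)
span-is-pencil (there (there (there (there (here refl))))) = union-of-lines-through (e8 , e13) (pt c)
  (syntheme c (duad (# 0) (# 1)) (duad (# 4) (# 5)))
  (syntheme c (duad (# 0) (# 4)) (duad (# 1) (# 5)))
  (syntheme c (duad (# 0) (# 5)) (duad (# 1) (# 4)))
  where c = duad (# 2) (# 3)
span-is-pencil (there (there (there (there (there (here refl)))))) = union-of-lines-through (e8 , e14) (pt c)
  (syntheme c (duad (# 0) (# 1)) (duad (# 2) (# 3)))
  (syntheme c (duad (# 0) (# 2)) (duad (# 1) (# 3)))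
  (syntheme c (duad (# 0) (# 3)) (duad (# 1) (# 2)))
  where c = duad (# 4) (# 5)
span-is-pencil (there (there (there (there (there (there (here refl))))))) = union-of-lines-through (e8 , e6) (pt c)
  (syntheme c (duad (# 0) (# 3)) (duad (# 4) (# 5)))
  (syntheme c (duad (# 0) (# 4)) (duad (# 3) (# 5)))
  (syntheme c (duad (# 0) (# 5)) (duad (# 3) (# 4)))
  where c = duad (# 1) (# 2)
span-is-pencil (there (there (there (there (there (there (there (here refl)))))))) = union-of-lines-through (e8 , e5) (pt c)
  (syntheme c (duad (# 1) (# 2)) (duad (# 3) (# 4)))
  (syntheme c (duad (# 1) (# 3)) (duad (# 2) (# 4)))
  (syntheme c (duad (# 1) (# 4)) (duad (# 2) (# 3)))
  where c = duad (# 0) (# 5)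
span-is-pencil (there (there (there (there (there (there (there (there (here refl))))))))) = union-of-lines-through (e8 , e3) (pt c)
  (syntheme c (duad (# 0) (# 1)) (duad (# 2) (# 5)))
  (syntheme c (duad (# 0) (# 2)) (duad (# 1) (# 5)))
  (syntheme c (duad (# 0) (# 5)) (duad (# 1) (# 2)))
  where c = duad (# 3) (# 4)

mainTheorem2 : (xy : Pt) → xy ∈ nine →
    (∃[ ps ] (length ps ≡ 7 × Unique ps
        × (∀ q → ((InSpan xy q × InJ2* q) → q ∈ ps) × (q ∈ ps → (InSpan xy q × InJ2* q)))))
    × (∃[ p ] ∃[ L₁ ] ∃[ L₂ ] ∃[ L₃ ]
        (OnLine p L₁ × OnLine p L₂ × OnLine p L₃
        × DistinctLines L₁ L₂ × DistinctLines L₁ L₃ × DistinctLines L₂ L₃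
        × (∀ q → ((InSpan xy q × InJ2* q) → (OnLine q L₁ ⊎ OnLine q L₂ ⊎ OnLine q L₃))
               × ((OnLine q L₁ ⊎ OnLine q L₂ ⊎ OnLine q L₃) → (InSpan xy q × InJ2* q)))))
mainTheorem2 xy xy∈nine =
  spanPoints-listing xy (All.lookup spans-have-seven-points xy∈nine) , span-is-pencil xy∈nine
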